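{- Let $G$ be a graph with minimum degree $1$. (i) If $G$ has a strong support vertex, then $d_g(G)=1=d_g'(G)$. (ii) If $G$ has even order, then $d_g(G)=1$. (iii) If $G$ has odd order, then $d_g'(G)=1$.
   Context: All graphs are finite and simple. A leaf is a vertex of degree $1$; a support vertex is a vertex adjacent to a leaf; a strong support vertex is a vertex adjacent to more than one leaf. For a vertex $x$, $N[x]$ denotes its closed neighborhood. The domatic number game on $G$ with palette $[k]=\{1,\dots,k\}$: two players, Alice and Bob, alternately choose a previously unchosen vertex of $G$ and assign it a color from $[k]$, until every vertex has been colored. Let $V_i$ be the set of vertices colored $i$. Alice wins if every $V_i$ ($i\in[k]$) is a dominating set of $G$, i.e. for every vertex $x$ and every color $c\in[k]$ some vertex of $N[x]$ has color $c$; otherwise Bob wins. In the $A$-game Alice moves first; in the $B$-game Bob moves first. The game domatic number $d_g(G)$ is the largest $k$ for which Alice has a winning strategy in the $A$-game with palette $[k]$, and the delayed game domatic number $d_g'(G)$ is the largest $k$ for which Alice has a winning strategy in the $B$-game with palette $[k]$. -}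

module Defs where

open import Data.Nat using (ℕ; zero; suc; _<_; _*_)
open import Data.Fin using (Fin; _≟_)
open import Data.Bool using (Bool; true; false; T)
open import Data.Maybe using (Maybe; just; nothing)
open import Data.List using (length; filter; allFin)
open import Data.Product using (Σ; ∃; _×_; _,_)
open import Data.Sum using (_⊎_)
open import Relation.Nullary using (¬_; yes; no)
open import Relation.Nullary.Decidable using (T?)
open import Relation.Binary.PropositionalEquality using (_≡_; _≢_)

record Graph (n : ℕ) : Set where
  field
    adj   : Fin n → Fin n → Bool
    sym   : ∀ u v → adj u v ≡ adj v u
    irrefl : ∀ v → adj v v ≡ false
open Graph public

module _ {n : ℕ} (G : Graph n) where

  degree : Fin n → ℕ
  degree v = length (filter (λ u → T? (adj G v u)) (allFin n))

  Adj : Fin n → Fin n → Set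
  Adj u v = T (adj G u v)

  MinDegreeOne : Set
  MinDegreeOne = (∀ v → 1 Data.Nat.≤ degree v) × ∃ λ v → degree v ≡ 1

  Leaf : Fin n → Set
  Leaf v = degree v ≡ 1

  StrongSupport : Fin n → Set
  StrongSupport x = Σ (Fin n) λ u → Σ (Fin n) λ w →
    u ≢ w × Adj x u × Adj x w × Leaf u × Leaf w

  HasStrongSupportVertex : Set
  HasStrongSupportVertex = ∃ λ x → StrongSupport x

  InClosedNbhd : Fin n → Fin n → Set
  InClosedNbhd x y = y ≡ x ⊎ Adj x y

  -- Partial colourings with palette [k] = Fin k (nothing = uncoloured).
  Colouring : ℕ → Set
  Colouring k = Fin n → Maybe (Fin k)

  paint : ∀ {k} → Colouring k → Fin n → Fin k → Colouring k
  paint f v c u with u ≟ v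
  ... | yes _ = just c
  ... | no  _ = f u

  AllClassesDominating : ∀ {k} → Colouring k → Set
  AllClassesDominating {k} f =
    ∀ (x : Fin n) (c : Fin k) → ∃ λ y → InClosedNbhd x y × f y ≡ just c

  FullyColoured : ∀ {k} → Colouring k → Set
  FullyColoured f = ∀ v → ∃ λ c → f v ≡ just c

  data Player : Set where
    alice bob : Player

  -- AliceWins k p f : from partial colouring f with player p to move,
  -- Alice has a winning strategy in the domatic number game with palette [k].
  data AliceWins (k : ℕ) : Player → Colouring k → Set where
    done     : ∀ {p f} → FullyColoured f → AllClassesDominating f → AliceWins k p f
    aliceMove : ∀ {f} (v : Fin n) (c : Fin k) → f v ≡ nothing →
                AliceWins k bob (paint f v c) → AliceWins k alice f
    bobMove  : ∀ {f} → (∃ λ u → f u ≡ nothing) →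
               (∀ (v : Fin n) (c : Fin k) → f v ≡ nothing →
                  AliceWins k alice (paint f v c)) →
               AliceWins k bob f

  empty : ∀ {k} → Colouring k
  empty _ = nothing

  AliceWinsAGame : ℕ → Set
  AliceWinsAGame k = AliceWins k alice empty

  AliceWinsBGame : ℕ → Set
  AliceWinsBGame k = AliceWins k bob empty

  GameDomaticNumberIs : ℕ → Set
  GameDomaticNumberIs d = AliceWinsAGame d × (∀ k → d < k → ¬ AliceWinsAGame k)

  DelayedGameDomaticNumberIs : ℕ → Set
  DelayedGameDomaticNumberIs d = AliceWinsBGame d × (∀ k → d < k → ¬ AliceWinsBGame k)

Even Odd : ℕ → Set
Even n = ∃ λ m → n ≡ 2 * m
Odd  n = ∃ λ m → n ≡ suc (2 * m)

{-# OPTIONS --safe #-}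
-- With one colour every complete colouring is dominating, so Alice always wins.
-- With k ≥ 2 colours, a leaf u and its support x coloured alike leave N[u] = {u, x}
-- without the other colours, so Bob wins as soon as he can copy the colour of u onto x
-- or vice versa. If x supports two leaves u and w, Bob copies whenever he can and
-- otherwise colours x; Alice then always faces two uncoloured leaves and can save at
-- most one. For a single leaf, Bob never touches u or x and waits for Alice to be forced
-- to; the parity of the number of uncoloured vertices decides whether she is, which is
-- why the parity of the order matters in (ii) and (iii).
module Submission where

open import Defs hiding (sym)
open import Data.Nat using (ℕ; zero; suc; _+_; _<_; s≤s)
open import Data.Nat.Properties using (+-suc; suc-injective)
open import Data.Fin using (Fin; zero; suc; _≟_; punchIn)
open import Data.Fin.Properties using (punchInᵢ≢i)
open import Data.Bool using (Bool; true; false; T; if_then_else_)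
open import Data.Maybe using (Maybe; just; nothing; is-nothing)
open import Data.Maybe.Properties using (just-injective)
open import Data.List using (List; []; _∷_; length; filter; allFin)
open import Data.List.Membership.Propositional using (_∈_)
open import Data.List.Membership.Propositional.Properties
  using (∈-filter⁺; ∈-filter⁻; ∈-allFin)
open import Data.List.Relation.Unary.Any using (here)
open import Data.Product using (∃; ∃₂; _×_; _,_; proj₁; proj₂)
open import Data.Sum using (_⊎_; inj₁; inj₂)
open import Function using (_∘_)
open import Relation.Nullary using (¬_; yes; no; does; contradiction)
open import Relation.Nullary.Decidable using (T?)
open import Relation.Binary.PropositionalEquality
  using (_≡_; _≢_; _≗_; refl; sym; trans; cong; cong₂; subst)

count : ∀ {n} → (Fin n → Bool) → ℕ
count {zero}  p = 0
count {suc n} p = (if p zero then 1 else 0) + count (p ∘ suc)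

infixl 5 _∖_

_∖_ : ∀ {n} → (Fin n → Bool) → Fin n → Fin n → Bool
(p ∖ a) i = if does (i ≟ a) then false else p i

count-cong : ∀ {n} {p q : Fin n → Bool} → p ≗ q → count p ≡ count q
count-cong {zero}  p≗q = refl
count-cong {suc n} p≗q =
  cong₂ (λ b m → (if b then 1 else 0) + m) (p≗q zero) (count-cong (p≗q ∘ suc))

count-all : ∀ n → count {n} (λ _ → true) ≡ n
count-all zero    = refl
count-all (suc n) = cong suc (count-all n)

count-∖ : ∀ {n} (p : Fin n → Bool) {a} → p a ≡ true → count p ≡ suc (count (p ∖ a))
count-∖ p {zero}  pa rewrite pa = refl
count-∖ p {suc a} pa =
  trans (cong ((if p zero then 1 else 0) +_) (count-∖ (p ∘ suc) pa)) (+-suc _ _)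

count-witness : ∀ {n} (p : Fin n → Bool) {m} → count p ≡ suc m → ∃ λ i → p i ≡ true
count-witness {suc n} p eq with p zero in pz
... | true  = zero , pz
... | false = let i , pi = count-witness (p ∘ suc) eq in suc i , pi

count≡0 : ∀ {n} (p : Fin n → Bool) → count p ≡ 0 → ∀ i → p i ≡ false
count≡0 {suc n} p eq i with p zero in pz
count≡0 {suc n} p eq zero    | false = pz
count≡0 {suc n} p eq (suc i) | false = count≡0 (p ∘ suc) eq i

∖-≢ : ∀ {n} (p : Fin n → Bool) {a i} → i ≢ a → (p ∖ a) i ≡ p i
∖-≢ p {a} {i} i≢a with i ≟ a
... | yes i≡a = contradiction i≡a i≢a
... | no _    = refl

∖-true : ∀ {n} (p : Fin n → Bool) a i → (p ∖ a) i ≡ true → i ≢ a × p i ≡ true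
∖-true p a i eq with i ≟ a
... | no i≢a = i≢a , eq

even-suc⇒odd : ∀ {m} → Even (suc m) → Odd m
even-suc⇒odd (suc j , eq) = j , trans (suc-injective eq) (+-suc j (j + 0))

odd-suc⇒even : ∀ {m} → Odd (suc m) → Even m
odd-suc⇒even (j , eq) = j , suc-injective eq

above-one : {P : ℕ → Set} → (∀ k → ¬ P (2 + k)) → ∀ k → 1 < k → ¬ P k
above-one ¬P (suc (suc k)) _ = ¬P k
above-one ¬P (suc zero) (s≤s ())

is-nothing⇒nothing : ∀ {A : Set} {m : Maybe A} → is-nothing m ≡ true → m ≡ nothing
is-nothing⇒nothing {m = nothing} _ = refl

length≡1⇒nonempty : ∀ {A : Set} {xs : List A} → length xs ≡ 1 → ∃ (_∈ xs)
length≡1⇒nonempty {xs = x ∷ _} _ = x , here refl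

length≡1⇒unique : ∀ {A : Set} {xs : List A} {y z} →
                   length xs ≡ 1 → y ∈ xs → z ∈ xs → y ≡ z
length≡1⇒unique {xs = _ ∷ []}    _  (here refl) (here refl) = refl
length≡1⇒unique {xs = _ ∷ _ ∷ _} ()

module _ {n : ℕ} (G : Graph n) where

  adj-sym : ∀ {u v} → Adj G u v → Adj G v u
  adj-sym {u} {v} = subst T (Graph.sym G u v)

  adj⇒≢ : ∀ {u v} → Adj G u v → u ≢ v
  adj⇒≢ {u} u~u refl = subst T (irrefl G u) u~u

  neighbours : Fin n → List (Fin n)
  neighbours u = filter (T? ∘ adj G u) (allFin n)

  ∈-neighbours : ∀ {u v} → Adj G u v → v ∈ neighbours u
  ∈-neighbours {u} {v} = ∈-filter⁺ (T? ∘ adj G u) (∈-allFin v)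

  leaf-neighbour : ∀ {u} → Leaf G u → ∃ (Adj G u)
  leaf-neighbour {u} leaf =
    let x , x∈ = length≡1⇒nonempty {xs = neighbours u} leaf
    in  x , proj₂ (∈-filter⁻ (T? ∘ adj G u) {xs = allFin n} x∈)

  leaf-neighbour-unique : ∀ {u x y} → Leaf G u → Adj G u x → Adj G u y → x ≡ y
  leaf-neighbour-unique {u} leaf u~x u~y =
    length≡1⇒unique {xs = neighbours u} leaf (∈-neighbours u~x) (∈-neighbours u~y)

  module _ {k : ℕ} where

    Coloured : Colouring G k → Fin n → Set
    Coloured f a = ∃ λ d → f a ≡ just d

    data SameColour (a b : Fin n) (f : Colouring G k) : Set where
      same-colour : ∀ {d} → f a ≡ just d → f b ≡ just d → SameColour a b f

    data HalfColoured (a b : Fin n) (f : Colouring G k) : Set where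
      only-first  : Coloured f a → f b ≡ nothing → HalfColoured a b f
      only-second : Coloured f b → f a ≡ nothing → HalfColoured a b f

    data BothUncoloured (a b : Fin n) (f : Colouring G k) : Set where
      both-uncoloured : f a ≡ nothing → f b ≡ nothing → BothUncoloured a b f

    coloured? : ∀ f a → Coloured f a ⊎ f a ≡ nothing
    coloured? f a with f a
    ... | just d  = inj₁ (d , refl)
    ... | nothing = inj₂ refl

    paint-≡ : ∀ (f : Colouring G k) v c → paint G f v c v ≡ just c
    paint-≡ f v c with v ≟ v
    ... | yes _   = refl
    ... | no v≢v = contradiction refl v≢v

    still-uncoloured : ∀ {f : Colouring G k} {v c a} → a ≢ v → f a ≡ nothing →
                       paint G f v c a ≡ nothing
    still-uncoloured {v = v} {a = a} a≢v fa with a ≟ v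
    ... | yes a≡v = contradiction a≡v a≢v
    ... | no _    = fa

    still-coloured : ∀ {f : Colouring G k} {v c a d} → f v ≡ nothing → f a ≡ just d →
                     paint G f v c a ≡ just d
    still-coloured {v = v} {a = a} fv fa with a ≟ v
    ... | yes refl = contradiction (trans (sym fv) fa) λ ()
    ... | no _     = fa

    sameColour-paint : ∀ {f : Colouring G k} {v c a b} → f v ≡ nothing → SameColour a b f →
                       SameColour a b (paint G f v c)
    sameColour-paint {f} fv (same-colour fa fb) =
      same-colour (still-coloured {f = f} fv fa) (still-coloured {f = f} fv fb)

    copy-colour : ∀ {f : Colouring G k} {a b} → HalfColoured a b f →
                  ∃₂ λ v c → f v ≡ nothing × SameColour a b (paint G f v c)
    copy-colour {f} {a} {b} (only-first (d , fa) fb) =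
      b , d , fb , same-colour (still-coloured {f = f} fb fa) (paint-≡ f b d)
    copy-colour {f} {a} {b} (only-second (d , fb) fa) =
      a , d , fa , same-colour (paint-≡ f a d) (still-coloured {f = f} fa fb)

    bothUncoloured-paint : ∀ {f : Colouring G k} {v c a b} → b ≢ a → BothUncoloured a b f →
                           HalfColoured a b (paint G f v c) ⊎ BothUncoloured a b (paint G f v c)
    bothUncoloured-paint {f} {v} {c} {a} {b} b≢a (both-uncoloured fa fb)
      with a ≟ v | coloured? (paint G f v c) b
    ... | yes refl | _       = inj₁ (only-first (c , paint-≡ f v c) (still-uncoloured b≢a fb))
    ... | no a≢v   | inj₁ cb = inj₁ (only-second cb (still-uncoloured a≢v fa))
    ... | no a≢v   | inj₂ gb = inj₂ (both-uncoloured (still-uncoloured a≢v fa) gb)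

    one-stays-uncoloured : ∀ {f : Colouring G k} {v c a b} → a ≢ b → BothUncoloured a b f →
                           paint G f v c a ≡ nothing ⊎ paint G f v c b ≡ nothing
    one-stays-uncoloured {v = v} {a = a} a≢b (both-uncoloured fa fb) with a ≟ v
    ... | yes refl = inj₂ (still-uncoloured (a≢b ∘ sym) fb)
    ... | no _     = inj₁ fa

    uncoloured⇒¬full : ∀ {f : Colouring G k} {a} → f a ≡ nothing → ¬ FullyColoured G f
    uncoloured⇒¬full {a = a} fa full =
      let _ , fa′ = full a in contradiction (trans (sym fa) fa′) λ ()

    halfColoured⇒¬full : ∀ {f : Colouring G k} {a b} → HalfColoured a b f →
                         ¬ FullyColoured G f
    halfColoured⇒¬full (only-first  _ fb) = uncoloured⇒¬full fb
    halfColoured⇒¬full (only-second _ fa) = uncoloured⇒¬full fa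

    uncoloured : Colouring G k → ℕ
    uncoloured f = count (is-nothing ∘ f)

    uncoloured-empty : uncoloured (empty G) ≡ n
    uncoloured-empty = count-all n

    uncoloured-paint : ∀ {f : Colouring G k} {v} c → f v ≡ nothing →
                       uncoloured f ≡ suc (uncoloured (paint G f v c))
    uncoloured-paint {f} {v} c fv =
      trans (count-∖ (is-nothing ∘ f) (cong is-nothing fv)) (cong suc (count-cong painted))
      where
      painted : (is-nothing ∘ f) ∖ v ≗ is-nothing ∘ paint G f v c
      painted i with i ≟ v
      ... | yes _ = refl
      ... | no _  = refl

    uncoloured-witness : ∀ {f : Colouring G k} {m} → uncoloured f ≡ suc m →
                         ∃ λ v → f v ≡ nothing
    uncoloured-witness {f} eq =
      let v , fv = count-witness (is-nothing ∘ f) eq in v , is-nothing⇒nothing fv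

    uncoloured≡0⇒full : ∀ {f : Colouring G k} → uncoloured f ≡ 0 → FullyColoured G f
    uncoloured≡0⇒full {f} none v with f v | count≡0 (is-nothing ∘ f) none v
    ... | just c | _ = c , refl

    uncoloured-outside : ∀ {f : Colouring G k} {u x} → u ≢ x → BothUncoloured u x f →
                         uncoloured f ≡ suc (suc (count ((is-nothing ∘ f) ∖ u ∖ x)))
    uncoloured-outside {f} {u} {x} u≢x (both-uncoloured fu fx) =
      trans (count-∖ (is-nothing ∘ f) (cong is-nothing fu))
            (cong suc (count-∖ ((is-nothing ∘ f) ∖ u) x-uncoloured))
      where
      x-uncoloured : ((is-nothing ∘ f) ∖ u) x ≡ true
      x-uncoloured = trans (∖-≢ (is-nothing ∘ f) (u≢x ∘ sym)) (cong is-nothing fx)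

    third-uncoloured : ∀ {f : Colouring G k} {u x} → u ≢ x → BothUncoloured u x f →
                       Odd (uncoloured f) → ∃ λ v → u ≢ v × x ≢ v × f v ≡ nothing
    third-uncoloured {f} {u} {x} u≢x both odd
      with _ , outside≡ ←
             even-suc⇒odd (odd-suc⇒even (subst Odd (uncoloured-outside u≢x both) odd))
      with v , hit ← count-witness ((is-nothing ∘ f) ∖ u ∖ x) outside≡
      with v≢x , hit′ ← ∖-true ((is-nothing ∘ f) ∖ u) x v hit
      with v≢u , fv ← ∖-true (is-nothing ∘ f) u v hit′
      = v , v≢u ∘ sym , v≢x ∘ sym , is-nothing⇒nothing fv

  sameColour⇒¬dominating : ∀ {k} {f : Colouring G (2 + k)} {u x} → Leaf G u → Adj G u x →
                           SameColour u x f → ¬ AllClassesDominating G f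
  sameColour⇒¬dominating {u = u} leaf u~x (same-colour {d} fu fx) dominating
    with dominating u (punchIn d zero)
  ... | _ , inj₁ refl , fy = punchInᵢ≢i d zero (just-injective (trans (sym fy) fu))
  ... | _ , inj₂ u~y  , fy with refl ← leaf-neighbour-unique leaf u~x u~y =
    punchInᵢ≢i d zero (just-injective (trans (sym fy) fx))

  fullyColoured⇒dominating : {f : Colouring G 1} → FullyColoured G f → AllClassesDominating G f
  fullyColoured⇒dominating full x zero with full x
  ... | zero , fx = x , inj₁ refl , fx

  alice-wins-with-one-colour : ∀ m {p} (f : Colouring G 1) → uncoloured f ≡ m →
                               AliceWins G 1 p f
  alice-wins-with-one-colour zero f none =
    done (uncoloured≡0⇒full none) (fullyColoured⇒dominating (uncoloured≡0⇒full none))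
  alice-wins-with-one-colour (suc m) {p} f eq = move p
    where
    fewer : ∀ {v c} → f v ≡ nothing → uncoloured (paint G f v c) ≡ m
    fewer {c = c} fv = suc-injective (trans (sym (uncoloured-paint c fv)) eq)
    move : ∀ p → AliceWins G 1 p f
    move alice = let v , fv = uncoloured-witness eq in
                 aliceMove v zero fv (alice-wins-with-one-colour m _ (fewer fv))
    move bob   = bobMove (uncoloured-witness eq) λ v c fv →
                 alice-wins-with-one-colour m _ (fewer fv)

  record BobStrategy (k : ℕ) : Set₁ where
    field
      Position    : Player G → Colouring G k → Set
      after-alice : ∀ {f v} c → f v ≡ nothing → Position alice f →
                    Position bob (paint G f v c)
      bob-reply   : ∀ {f} → Position bob f → (∃ λ u → f u ≡ nothing) →
                    ∃₂ λ v c → f v ≡ nothing × Position alice (paint G f v c)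
      spoilt      : ∀ {p f} → Position p f → FullyColoured G f → ¬ AllClassesDominating G f

    alice-cannot-win : ∀ {p f} → Position p f → ¬ AliceWins G k p f
    alice-cannot-win pos (done full dominating) = spoilt pos full dominating
    alice-cannot-win pos (aliceMove v c fv win) = alice-cannot-win (after-alice c fv pos) win
    alice-cannot-win pos (bobMove unfinished wins)
      with v , c , fv , pos′ ← bob-reply pos unfinished = alice-cannot-win pos′ (wins v c fv)

  module LeafParityStrategy (k : ℕ) {u x : Fin n} (leaf : Leaf G u) (u~x : Adj G u x) where

    u≢x : u ≢ x
    u≢x = adj⇒≢ u~x

    Position : Player G → Colouring G (2 + k) → Set
    Position alice f = SameColour u x f ⊎ BothUncoloured u x f × Even (uncoloured f)
    Position bob   f = SameColour u x f ⊎ HalfColoured u x f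
                     ⊎ BothUncoloured u x f × Odd (uncoloured f)

    after-alice : ∀ {f v} c → f v ≡ nothing → Position alice f →
                  Position bob (paint G f v c)
    after-alice c fv (inj₁ same) = inj₁ (sameColour-paint fv same)
    after-alice c fv (inj₂ (both , even)) with bothUncoloured-paint {c = c} (u≢x ∘ sym) both
    ... | inj₁ half  = inj₂ (inj₁ half)
    ... | inj₂ both′ =
      inj₂ (inj₂ (both′ , even-suc⇒odd (subst Even (uncoloured-paint c fv) even)))

    bob-reply : ∀ {f} → Position bob f → (∃ λ v → f v ≡ nothing) →
                ∃₂ λ v c → f v ≡ nothing × Position alice (paint G f v c)
    bob-reply (inj₁ same) (v , fv) = v , zero , fv , inj₁ (sameColour-paint fv same)
    bob-reply (inj₂ (inj₁ half)) _ =
      let v , c , fv , same = copy-colour half in v , c , fv , inj₁ same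
    bob-reply (inj₂ (inj₂ (both@(both-uncoloured fu fx) , odd))) _
      with v , u≢v , x≢v , fv ← third-uncoloured u≢x both odd =
      v , zero , fv ,
      inj₂ (both-uncoloured (still-uncoloured u≢v fu) (still-uncoloured x≢v fx) ,
            odd-suc⇒even (subst Odd (uncoloured-paint zero fv) odd))

    spoilt : ∀ {p f} → Position p f → FullyColoured G f → ¬ AllClassesDominating G f
    spoilt {alice} (inj₁ same) _ = sameColour⇒¬dominating leaf u~x same
    spoilt {alice} (inj₂ (both-uncoloured fu _ , _)) full _ = uncoloured⇒¬full fu full
    spoilt {bob} (inj₁ same) _ = sameColour⇒¬dominating leaf u~x same
    spoilt {bob} (inj₂ (inj₁ half)) full _ = halfColoured⇒¬full half full
    spoilt {bob} (inj₂ (inj₂ (both-uncoloured fu _ , _))) full _ = uncoloured⇒¬full fu full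

    strategy : BobStrategy (2 + k)
    strategy = record
      { Position = Position ; after-alice = after-alice ; bob-reply = bob-reply ; spoilt = spoilt }

    open BobStrategy strategy using (alice-cannot-win)

    a-game-lost : Even n → ¬ AliceWinsAGame G (2 + k)
    a-game-lost even = alice-cannot-win
      (inj₂ (both-uncoloured refl refl , subst Even (sym (uncoloured-empty {2 + k})) even))

    b-game-lost : Odd n → ¬ AliceWinsBGame G (2 + k)
    b-game-lost odd = alice-cannot-win
      (inj₂ (inj₂ (both-uncoloured refl refl , subst Odd (sym (uncoloured-empty {2 + k})) odd)))

  module StrongSupportStrategy (k : ℕ) {u w x : Fin n} (u≢w : u ≢ w)
           (leaf-u : Leaf G u) (leaf-w : Leaf G w) (u~x : Adj G u x) (w~x : Adj G w x) where

    Trapped : Fin n → Fin n → Colouring G (2 + k) → Set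
    Trapped a b f = SameColour a x f ⊎ SameColour b x f ⊎ BothUncoloured a b f

    trapped-sym : ∀ {a b f} → Trapped a b f → Trapped b a f
    trapped-sym (inj₁ same)        = inj₂ (inj₁ same)
    trapped-sym (inj₂ (inj₁ same)) = inj₁ same
    trapped-sym (inj₂ (inj₂ (both-uncoloured fa fb))) = inj₂ (inj₂ (both-uncoloured fb fa))

    trap : ∀ {f a b} → a ≢ x → b ≢ x → f a ≡ nothing →
           ∃₂ λ v c → f v ≡ nothing × Trapped a b (paint G f v c)
    trap {f} {a} {b} a≢x b≢x fa with coloured? f x | coloured? f b
    ... | inj₁ cx | _ =
      let v , c , fv , same = copy-colour (only-second cx fa) in v , c , fv , inj₁ same
    ... | inj₂ fx | inj₁ cb =
      let v , c , fv , same = copy-colour (only-first cb fx) in v , c , fv , inj₂ (inj₁ same)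
    ... | inj₂ fx | inj₂ fb =
      x , zero , fx ,
      inj₂ (inj₂ (both-uncoloured (still-uncoloured a≢x fa) (still-uncoloured b≢x fb)))

    Position : Player G → Colouring G (2 + k) → Set
    Position alice f = Trapped u w f
    Position bob   f = SameColour u x f ⊎ SameColour w x f ⊎ f u ≡ nothing ⊎ f w ≡ nothing

    after-alice : ∀ {f v} c → f v ≡ nothing → Position alice f →
                  Position bob (paint G f v c)
    after-alice c fv (inj₁ same)         = inj₁ (sameColour-paint fv same)
    after-alice c fv (inj₂ (inj₁ same))  = inj₂ (inj₁ (sameColour-paint fv same))
    after-alice c fv (inj₂ (inj₂ both))  = inj₂ (inj₂ (one-stays-uncoloured u≢w both))

    bob-reply : ∀ {f} → Position bob f → (∃ λ v → f v ≡ nothing) →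
                ∃₂ λ v c → f v ≡ nothing × Position alice (paint G f v c)
    bob-reply (inj₁ same)        (v , fv) = v , zero , fv , inj₁ (sameColour-paint fv same)
    bob-reply (inj₂ (inj₁ same)) (v , fv) =
      v , zero , fv , inj₂ (inj₁ (sameColour-paint fv same))
    bob-reply (inj₂ (inj₂ (inj₁ fu))) _ = trap (adj⇒≢ u~x) (adj⇒≢ w~x) fu
    bob-reply (inj₂ (inj₂ (inj₂ fw))) _ =
      let v , c , fv , trapped = trap (adj⇒≢ w~x) (adj⇒≢ u~x) fw
      in  v , c , fv , trapped-sym trapped

    spoilt : ∀ {p f} → Position p f → FullyColoured G f → ¬ AllClassesDominating G f
    spoilt {alice} (inj₁ same) _ = sameColour⇒¬dominating leaf-u u~x same
    spoilt {alice} (inj₂ (inj₁ same)) _ = sameColour⇒¬dominating leaf-w w~x same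
    spoilt {alice} (inj₂ (inj₂ (both-uncoloured fu _))) full _ = uncoloured⇒¬full fu full
    spoilt {bob} (inj₁ same) _ = sameColour⇒¬dominating leaf-u u~x same
    spoilt {bob} (inj₂ (inj₁ same)) _ = sameColour⇒¬dominating leaf-w w~x same
    spoilt {bob} (inj₂ (inj₂ (inj₁ fu))) full _ = uncoloured⇒¬full fu full
    spoilt {bob} (inj₂ (inj₂ (inj₂ fw))) full _ = uncoloured⇒¬full fw full

    strategy : BobStrategy (2 + k)
    strategy = record
      { Position = Position ; after-alice = after-alice ; bob-reply = bob-reply ; spoilt = spoilt }

    open BobStrategy strategy using (alice-cannot-win)

    a-game-lost : ¬ AliceWinsAGame G (2 + k)
    a-game-lost = alice-cannot-win (inj₂ (inj₂ (both-uncoloured refl refl)))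

    b-game-lost : ¬ AliceWinsBGame G (2 + k)
    b-game-lost = alice-cannot-win (inj₂ (inj₂ (inj₁ refl)))

  strongSupport⇒bob-wins : HasStrongSupportVertex G →
                           ∀ k → ¬ AliceWinsAGame G (2 + k) × ¬ AliceWinsBGame G (2 + k)
  strongSupport⇒bob-wins (x , u , w , u≢w , x~u , x~w , leaf-u , leaf-w) k =
    a-game-lost , b-game-lost
    where open StrongSupportStrategy k u≢w leaf-u leaf-w (adj-sym x~u) (adj-sym x~w)

  game-domatic-number-one : (∀ k → ¬ AliceWinsAGame G (2 + k)) → GameDomaticNumberIs G 1
  game-domatic-number-one lost = alice-wins-with-one-colour _ (empty G) refl , above-one lost

  delayed-game-domatic-number-one : (∀ k → ¬ AliceWinsBGame G (2 + k)) →
                                    DelayedGameDomaticNumberIs G 1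
  delayed-game-domatic-number-one lost = alice-wins-with-one-colour _ (empty G) refl , above-one lost

proposition3p3 : ∀ (n : ℕ) (G : Graph n) → MinDegreeOne G →
    (HasStrongSupportVertex G →
      GameDomaticNumberIs G 1 × DelayedGameDomaticNumberIs G 1)
    × (Even n → GameDomaticNumberIs G 1)
    × (Odd n → DelayedGameDomaticNumberIs G 1)
proposition3p3 n G (_ , _ , leaf) with _ , u~x ← leaf-neighbour G leaf =
    (λ strong → game-domatic-number-one G (proj₁ ∘ strongSupport⇒bob-wins G strong)
              , delayed-game-domatic-number-one G (proj₂ ∘ strongSupport⇒bob-wins G strong))
  , (λ even → game-domatic-number-one G λ k → a-game-lost G k leaf u~x even)
  , (λ odd → delayed-game-domatic-number-one G λ k → b-game-lost G k leaf u~x odd)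
  where open LeafParityStrategy using (a-game-lost; b-game-lost)
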